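{- (i) For every finite simple graph $G$, $\mathrm{diadem}(G)\subseteq\mathrm{corona}(G)$; if $G$ is a König–Egerváry graph, then $\mathrm{diadem}(G)=\mathrm{corona}(G)$. (ii) If $G$ is a König–Egerváry graph, then $|\ker(G)|+|\mathrm{diadem}(G)|\le 2\alpha(G)$.
   Context: For $X\subseteq V(G)$, $N(X)$ is the set of vertices adjacent to some vertex of $X$ and $d(X)=|X|-|N(X)|$. An independent set $A$ is a critical independent set if $d(A)=\max\{d(I): I \text{ independent in } G\}$. $\ker(G)$ is the intersection and $\mathrm{diadem}(G)$ the union of all critical independent sets of $G$. $\alpha(G)$ is the independence number, $\Omega(G)$ the family of maximum independent sets, $\mathrm{corona}(G)=\bigcup\Omega(G)$. $\mu(G)$ is the matching number; $G$ is König–Egerváry if $\alpha(G)+\mu(G)=|V(G)|$. -}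

module Defs where

open import Data.Nat using (ℕ; _+_; _≤_)
open import Data.Bool using (Bool; true; false; _∧_; T)
open import Data.Fin using (Fin)
open import Data.Fin.Subset using (Subset; _∈_; ∣_∣)
open import Data.Vec using (lookup; tabulate)
open import Data.List using (allFin)
open import Data.Bool.ListAction using (any)
open import Data.Empty using () renaming (⊥ to Empty)
open import Data.Integer as ℤ using (ℤ; +_; _-_)
open import Data.Product using (Σ; _×_; ∃)
open import Data.Sum using (_⊎_; [_,_])
open import Relation.Binary.PropositionalEquality using (_≡_)
open import Function.Definitions using (Injective)

record Graph (n : ℕ) : Set where
  field
    adj   : Fin n → Fin n → Bool
    sym   : ∀ i j → adj i j ≡ adj j i
    loopless : ∀ i → adj i i ≡ false
open Graph public

module _ {n : ℕ} (G : Graph n) where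

  Adjacent : Fin n → Fin n → Set
  Adjacent i j = T (adj G i j)

  N : Subset n → Subset n
  N X = tabulate (λ j → any (λ i → lookup X i ∧ adj G i j) (allFin n))

  d : Subset n → ℤ
  d X = + ∣ X ∣ - + ∣ N X ∣

  Independent : Subset n → Set
  Independent A = ∀ i j → i ∈ A → j ∈ A → Adjacent i j → Empty

  CriticalIndependent : Subset n → Set
  CriticalIndependent A =
    Independent A × (∀ I → Independent I → d I ℤ.≤ d A)

  MaximumIndependent : Subset n → Set
  MaximumIndependent S = Independent S × (∀ I → Independent I → ∣ I ∣ ≤ ∣ S ∣)

  InDiadem : Fin n → Set
  InDiadem x = ∃ λ A → CriticalIndependent A × x ∈ A

  InKer : Fin n → Set
  InKer x = ∀ A → CriticalIndependent A → x ∈ A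

  InCorona : Fin n → Set
  InCorona x = ∃ λ S → MaximumIndependent S × x ∈ S

  IsKer : Subset n → Set
  IsKer K = ∀ x → (x ∈ K → InKer x) × (InKer x → x ∈ K)

  IsDiadem : Subset n → Set
  IsDiadem D = ∀ x → (x ∈ D → InDiadem x) × (InDiadem x → x ∈ D)

  -- a matching with k edges: edge e joins (u e) and (v e); all 2k endpoints distinct
  Matching : ℕ → Set
  Matching k = Σ (Fin k → Fin n) λ u → Σ (Fin k → Fin n) λ v →
    (∀ e → Adjacent (u e) (v e)) × Injective _≡_ _≡_ [ u , v ]

  IsMatchingNumber : ℕ → Set
  IsMatchingNumber k = Matching k × (∀ m → Matching m → m ≤ k)

  KonigEgervary : Set
  KonigEgervary = ∃ λ S → ∃ λ k →
    MaximumIndependent S × IsMatchingNumber k × ∣ S ∣ + k ≡ n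

-- A critical independent set A extends to a maximum one: for maximum S, comparing d(A) with
-- d(A ∖ N(Y)) gives the Hall-type bound |Y| ≤ |A ∩ N(Y)| for Y = S ∩ N(A), so A ∪ (S ∖ N(A)) is
-- independent and no smaller than S.
-- A matching with μ edges gives |I| + 2μ ≤ n + |N(I)| for every I, since each matching edge
-- contributes at least 2 to |V ∖ I| + |N(I)|; when α + μ = n this says d(I) ≤ α − μ ≤ d(S) for a
-- maximum S, so maximum sets are critical and corona = diadem.  Then no edge joins ker to diadem,
-- so each matching edge also contributes 2 to |V ∖ ker| + |V ∖ diadem|, whence
-- |ker| + |diadem| + 2μ ≤ 2n = 2α + 2μ.
module Submission where

open import Defs hiding (sym)
open import Data.Nat using (ℕ; _+_; _*_; _≤_)
open import Data.Fin using (Fin)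
open import Data.Fin.Subset using (Subset; ∣_∣)
open import Data.Product using (_×_)
open import Function.Bundles using (_⇔_)

open import Data.Bool using (T; true; false; if_then_else_)
open import Data.Empty using (⊥-elim)
open import Data.Fin using (zero; suc; splitAt; join; punchOut; punchIn)
open import Data.Fin.Properties
  using (all?; join-splitAt; punchOut-injective; punchIn-punchOut; 0≢1+n; suc-injective)
open import Data.Fin.Subset using (_∈_; _⊆_; _∩_; _∪_; ∁; ⊤; ⊥)
open import Data.Fin.Subset.Properties
  using ( _∈?_; anySubset?; ∣p∣≤n; ∣⊤∣≡n; ∣∁p∣≡n∸∣p∣; p⊆q⇒∣p∣≤∣q∣; ⊆⊤; ∉⊥
        ; x∈p∩q⁺; x∈p∩q⁻; x∈p∪q⁺; x∈p∪q⁻; x∉p⇒x∈∁p; x∈∁p⇒x∉p)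
open import Data.Integer as ℤ using (ℤ; _-_; +≤+; 0ℤ)
open import Data.Integer.Properties using (pos-+; drop‿+≤+; i≤j⇒0≤j-i; 0≤i-j⇒j≤i)
open import Data.Integer.Tactic.RingSolver using () renaming (solve-∀ to ℤ-solve-∀)
open import Data.List using (allFin)
open import Data.List.Membership.Propositional using (lose)
open import Data.List.Membership.Propositional.Properties using (∈-allFin)
open import Data.List.Relation.Unary.Any using (satisfied)
open import Data.List.Relation.Unary.Any.Properties using (any⁺; any⁻)
open import Data.Nat using (zero; suc; z≤n; s≤s; _≤?_)
open import Data.Nat.Properties
  using ( +-0-commutativeMonoid; module ≤-Reasoning; ≤-trans; ≤-reflexive; ≤-antisym; ≮⇒≥
        ; +-assoc; +-suc; +-identityʳ; *-comm; m≤n+m; m+[n∸m]≡n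
        ; +-mono-≤; +-monoˡ-≤; +-monoʳ-≤; +-cancelˡ-≤; +-cancelʳ-≤)
open import Algebra.Properties.CommutativeMonoid.Sum +-0-commutativeMonoid
  using (sum; ∑-distrib-+; sum-remove; sum-cong-≗)
open import Data.Nat.Tactic.RingSolver using (solve-∀)
open import Data.Product using (Σ; ∃; _,_; proj₁; proj₂)
open import Data.Sum using (_⊎_; inj₁; inj₂; [_,_]; map₁)
open import Data.Vec using (_∷_; []; lookup; tabulate)
open import Data.Vec.Properties using (lookup∘tabulate; []=⇒lookup; lookup⇒[]=)
open import Data.Bool.Properties using (T-≡; T-∧)
open import Function using (_∘_; case_of_)
open import Function.Bundles using (Equivalence; mk⇔)
open import Function.Definitions using (Injective)
open import Relation.Binary.PropositionalEquality hiding ([_])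
open import Relation.Nullary using (Dec; yes; no; ¬_; contradiction)
open import Relation.Nullary.Decidable using (_×-dec_; _→-dec_; T?)

∑-mono-≤ : ∀ {n} {f g : Fin n → ℕ} → (∀ i → f i ≤ g i) → sum f ≤ sum g
∑-mono-≤ {zero}  f≤g = z≤n
∑-mono-≤ {suc n} f≤g = +-mono-≤ (f≤g zero) (∑-mono-≤ (f≤g ∘ suc))

∑-const : ∀ n c → sum {n} (λ _ → c) ≡ n * c
∑-const zero    c = refl
∑-const (suc n) c = cong (c +_) (∑-const n c)

∑-splitAt : ∀ m {n} (g : Fin m ⊎ Fin n → ℕ) →
            sum (g ∘ splitAt m) ≡ sum (g ∘ inj₁) + sum (g ∘ inj₂)
∑-splitAt zero    g = refl
∑-splitAt (suc m) g = begin
  g (inj₁ zero) + sum (g ∘ map₁ suc ∘ splitAt m)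
    ≡⟨ cong (g (inj₁ zero) +_) (∑-splitAt m (g ∘ map₁ suc)) ⟩
  g (inj₁ zero) + (sum (g ∘ inj₁ ∘ suc) + sum (g ∘ inj₂))
    ≡⟨ +-assoc (g (inj₁ zero)) _ _ ⟨
  sum (g ∘ inj₁) + sum (g ∘ inj₂) ∎
  where open ≡-Reasoning

-- Split off the term h (f zero) of the right-hand sum; the rest of f then lands, via punchOut,
-- injectively in the remaining n terms.
∑-injective-≤ : ∀ {m n} {f : Fin m → Fin n} → Injective _≡_ _≡_ f →
                (h : Fin n → ℕ) → sum (h ∘ f) ≤ sum h
∑-injective-≤ {zero}          f-inj h = z≤n
∑-injective-≤ {suc m} {zero}  {f} f-inj h with f zero
... | ()
∑-injective-≤ {suc m} {suc n} {f} f-inj h = begin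
  h (f zero) + sum (h ∘ f ∘ suc)
    ≡⟨ cong (h (f zero) +_) (sum-cong-≗ (cong h ∘ sym ∘ punchIn-punchOut ∘ f₀≢)) ⟩
  h (f zero) + sum (h ∘ punchIn (f zero) ∘ g)
    ≤⟨ +-monoʳ-≤ (h (f zero)) (∑-injective-≤ g-injective (h ∘ punchIn (f zero))) ⟩
  h (f zero) + sum (h ∘ punchIn (f zero))
    ≡⟨ sum-remove {i = f zero} h ⟨
  sum h ∎
  where
  open ≤-Reasoning
  f₀≢ : ∀ i → f zero ≢ f (suc i)
  f₀≢ i = 0≢1+n ∘ f-inj
  g : Fin m → Fin n
  g i = punchOut (f₀≢ i)
  g-injective : Injective _≡_ _≡_ g
  g-injective = suc-injective ∘ f-inj ∘ punchOut-injective (f₀≢ _) (f₀≢ _)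

∑-pair-injective-≤ : ∀ {k n} {u v : Fin k → Fin n} → Injective _≡_ _≡_ [ u , v ] →
                     (h : Fin n → ℕ) → sum (h ∘ u) + sum (h ∘ v) ≤ sum h
∑-pair-injective-≤ {k} {u = u} {v} uv-inj h = begin
  sum (h ∘ u) + sum (h ∘ v)       ≡⟨ ∑-splitAt k (h ∘ [ u , v ]) ⟨
  sum (h ∘ [ u , v ] ∘ splitAt k) ≤⟨ ∑-injective-≤ (splitAt-injective ∘ uv-inj) h ⟩
  sum h                           ∎
  where
  open ≤-Reasoning
  splitAt-injective : Injective _≡_ _≡_ (splitAt k {k})
  splitAt-injective {i} {j} eq =
    trans (sym (join-splitAt k k i)) (trans (cong (join k k) eq) (join-splitAt k k j))

indicator : ∀ {n} → Subset n → Fin n → ℕ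
indicator p i = if lookup p i then 1 else 0

∣p∣≡∑indicator : ∀ {n} (p : Subset n) → ∣ p ∣ ≡ sum (indicator p)
∣p∣≡∑indicator []          = refl
∣p∣≡∑indicator (true ∷ p)  = cong suc (∣p∣≡∑indicator p)
∣p∣≡∑indicator (false ∷ p) = ∣p∣≡∑indicator p

x∈p⇒indicator≡1 : ∀ {n} {p : Subset n} {x} → x ∈ p → indicator p x ≡ 1
x∈p⇒indicator≡1 x∈p rewrite []=⇒lookup x∈p = refl

∣p∣≡∣p∩q∣+∣p∩∁q∣ : ∀ {n} (p q : Subset n) → ∣ p ∣ ≡ ∣ p ∩ q ∣ + ∣ p ∩ ∁ q ∣
∣p∣≡∣p∩q∣+∣p∩∁q∣ []          []          = refl
∣p∣≡∣p∩q∣+∣p∩∁q∣ (true ∷ p)  (true ∷ q)  = cong suc (∣p∣≡∣p∩q∣+∣p∩∁q∣ p q)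
∣p∣≡∣p∩q∣+∣p∩∁q∣ (true ∷ p)  (false ∷ q) =
  trans (cong suc (∣p∣≡∣p∩q∣+∣p∩∁q∣ p q)) (sym (+-suc _ _))
∣p∣≡∣p∩q∣+∣p∩∁q∣ (false ∷ p) (_ ∷ q)     = ∣p∣≡∣p∩q∣+∣p∩∁q∣ p q

∣p∣+∣q∣≤∣r∣ : ∀ {n} {p q r : Subset n} → p ⊆ r → q ⊆ r → q ⊆ ∁ p → ∣ p ∣ + ∣ q ∣ ≤ ∣ r ∣
∣p∣+∣q∣≤∣r∣ {p = p} {q} {r} p⊆r q⊆r q⊆∁p = begin
  ∣ p ∣ + ∣ q ∣                 ≤⟨ +-mono-≤ (p⊆q⇒∣p∣≤∣q∣ p⊆r∩p) (p⊆q⇒∣p∣≤∣q∣ q⊆r∩∁p) ⟩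
  ∣ r ∩ p ∣ + ∣ r ∩ ∁ p ∣       ≡⟨ ∣p∣≡∣p∩q∣+∣p∩∁q∣ r p ⟨
  ∣ r ∣                         ∎
  where
  open ≤-Reasoning
  p⊆r∩p : p ⊆ r ∩ p
  p⊆r∩p x∈p = x∈p∩q⁺ (p⊆r x∈p , x∈p)
  q⊆r∩∁p : q ⊆ r ∩ ∁ p
  q⊆r∩∁p x∈q = x∈p∩q⁺ (q⊆r x∈q , q⊆∁p x∈q)

∣p∣+∣∁p∣≡n : ∀ {n} (p : Subset n) → ∣ p ∣ + ∣ ∁ p ∣ ≡ n
∣p∣+∣∁p∣≡n p = trans (cong (∣ p ∣ +_) (∣∁p∣≡n∸∣p∣ p)) (m+[n∸m]≡n (∣p∣≤n p))

[+a-+b]≤[+c-+d]⇔a+d≤c+b : ∀ a b c d → (ℤ.+ a - ℤ.+ b ℤ.≤ ℤ.+ c - ℤ.+ d) ⇔ (a + d ≤ c + b)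
[+a-+b]≤[+c-+d]⇔a+d≤c+b a b c d = mk⇔
  (λ le → drop‿+≤+ (0≤i-j⇒j≤i (subst (0ℤ ℤ.≤_) difference (i≤j⇒0≤j-i le))))
  (λ le → 0≤i-j⇒j≤i (subst (0ℤ ℤ.≤_) (sym difference) (i≤j⇒0≤j-i (+≤+ le))))
  where
  rearrange : ∀ (a b c d : ℤ) → (c - d) - (a - b) ≡ (c ℤ.+ b) - (a ℤ.+ d)
  rearrange = ℤ-solve-∀
  difference : (ℤ.+ c - ℤ.+ d) - (ℤ.+ a - ℤ.+ b) ≡ ℤ.+ (c + b) - ℤ.+ (a + d)
  difference = trans (rearrange (ℤ.+ a) (ℤ.+ b) (ℤ.+ c) (ℤ.+ d))
                     (sym (cong₂ _-_ (pos-+ c b) (pos-+ a d)))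

module _ {n : ℕ} (G : Graph n) where

  adjacent-sym : ∀ {i j} → Adjacent G i j → Adjacent G j i
  adjacent-sym {i} {j} = subst T (Graph.sym G i j)

  ∈N⁺ : ∀ {X i j} → i ∈ X → Adjacent G i j → j ∈ N G X
  ∈N⁺ {X} {i} {j} i∈X i~j = lookup⇒[]= j (N G X) (trans (lookup∘tabulate _ j) (Equivalence.to T-≡
    (any⁺ _ (lose (∈-allFin i) (Equivalence.from T-∧ (Equivalence.from T-≡ ([]=⇒lookup i∈X) , i~j))))))

  ∈N⁻ : ∀ {X j} → j ∈ N G X → ∃ λ i → i ∈ X × Adjacent G i j
  ∈N⁻ {X} {j} j∈NX with satisfied (any⁻ _ (allFin n)
    (Equivalence.from T-≡ (trans (sym (lookup∘tabulate _ j)) ([]=⇒lookup j∈NX))))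
  ... | i , i∈X∧i~j with Equivalence.to T-∧ i∈X∧i~j
  ...   | i∈X , i~j = i , lookup⇒[]= i X (Equivalence.to T-≡ i∈X) , i~j

  N-mono : ∀ {X Y} → X ⊆ Y → N G X ⊆ N G Y
  N-mono X⊆Y j∈NX with ∈N⁻ j∈NX
  ... | i , i∈X , i~j = ∈N⁺ (X⊆Y i∈X) i~j

  d≤d⇔ : ∀ X Y → d G X ℤ.≤ d G Y ⇔ ∣ X ∣ + ∣ N G Y ∣ ≤ ∣ Y ∣ + ∣ N G X ∣
  d≤d⇔ X Y = [+a-+b]≤[+c-+d]⇔a+d≤c+b (∣ X ∣) (∣ N G X ∣) (∣ Y ∣) (∣ N G Y ∣)

  independent-⊆ : ∀ {A B} → A ⊆ B → Independent G B → Independent G A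
  independent-⊆ A⊆B indB i j i∈A j∈A = indB i j (A⊆B i∈A) (A⊆B j∈A)

  independent⇒N⊆∁ : ∀ {A} → Independent G A → N G A ⊆ ∁ A
  independent⇒N⊆∁ indA {j} j∈NA with ∈N⁻ j∈NA
  ... | i , i∈A , i~j = x∉p⇒x∈∁p (λ j∈A → indA i j i∈A j∈A i~j)

  independent⇒∣A∣+∣NA∣≤n : ∀ {A} → Independent G A → ∣ A ∣ + ∣ N G A ∣ ≤ n
  independent⇒∣A∣+∣NA∣≤n {A} indA =
    subst (∣ A ∣ + ∣ N G A ∣ ≤_) (∣⊤∣≡n n) (∣p∣+∣q∣≤∣r∣ {r = ⊤} ⊆⊤ ⊆⊤ (independent⇒N⊆∁ indA))

  independent? : (A : Subset n) → Dec (Independent G A)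
  independent? A = all? λ i → all? λ j →
    i ∈? A →-dec (j ∈? A →-dec (T? (adj G i j) →-dec no λ ()))

  maximumIndependent : Σ (Subset n) (MaximumIndependent G)
  maximumIndependent = grow n ⊥ (λ i j i∈⊥ → contradiction i∈⊥ ∉⊥) (m≤n+m n ∣ ⊥ {n} ∣)
    where
    grow : ∀ t I → Independent G I → n ≤ ∣ I ∣ + t → Σ (Subset n) (MaximumIndependent G)
    grow zero    I indI n≤∣I∣+0 =
      I , indI , λ J _ → ≤-trans (∣p∣≤n J) (subst (n ≤_) (+-identityʳ ∣ I ∣) n≤∣I∣+0)
    grow (suc t) I indI n≤∣I∣+1+t with anySubset? (λ J → independent? J ×-dec (suc ∣ I ∣ ≤? ∣ J ∣))
    ... | no ∄J = I , indI , λ J indJ → ≮⇒≥ (λ ∣I∣<∣J∣ → ∄J (J , indJ , ∣I∣<∣J∣))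
    ... | yes (J , indJ , ∣I∣<∣J∣) = grow t J indJ
      (≤-trans n≤∣I∣+1+t (≤-trans (≤-reflexive (+-suc ∣ I ∣ t)) (+-monoˡ-≤ t ∣I∣<∣J∣)))

  critical⇒∣Y∣≤∣A∩NY∣ : ∀ {A Y} → CriticalIndependent G A → Y ⊆ N G A → ∣ Y ∣ ≤ ∣ A ∩ N G Y ∣
  critical⇒∣Y∣≤∣A∩NY∣ {A} {Y} (indA , d≤dA) Y⊆NA = +-cancelˡ-≤ (∣ A′ ∣ + ∣ N G A′ ∣) _ _ (begin
    (∣ A′ ∣ + ∣ N G A′ ∣) + ∣ Y ∣          ≡⟨ +-assoc (∣ A′ ∣) _ _ ⟩
    ∣ A′ ∣ + (∣ N G A′ ∣ + ∣ Y ∣)          ≤⟨ +-monoʳ-≤ (∣ A′ ∣) (∣p∣+∣q∣≤∣r∣ (N-mono A′⊆A) Y⊆NA Y⊆∁NA′) ⟩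
    ∣ A′ ∣ + ∣ N G A ∣                    ≤⟨ Equivalence.to (d≤d⇔ A′ A) (d≤dA A′ indA′) ⟩
    ∣ A ∣ + ∣ N G A′ ∣                    ≡⟨ cong (_+ ∣ N G A′ ∣) (∣p∣≡∣p∩q∣+∣p∩∁q∣ A (N G Y)) ⟩
    (∣ A ∩ N G Y ∣ + ∣ A′ ∣) + ∣ N G A′ ∣  ≡⟨ rearrange (∣ A ∩ N G Y ∣) (∣ A′ ∣) (∣ N G A′ ∣) ⟩
    (∣ A′ ∣ + ∣ N G A′ ∣) + ∣ A ∩ N G Y ∣  ∎)
    where
    open ≤-Reasoning
    A′ : Subset n
    A′ = A ∩ ∁ (N G Y)
    A′⊆A : A′ ⊆ A
    A′⊆A = proj₁ ∘ x∈p∩q⁻ A _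
    indA′ : Independent G A′
    indA′ = independent-⊆ A′⊆A indA
    Y⊆∁NA′ : Y ⊆ ∁ (N G A′)
    Y⊆∁NA′ y∈Y = x∉p⇒x∈∁p λ y∈NA′ → case ∈N⁻ y∈NA′ of λ where
      (a , a∈A′ , a~y) → x∈∁p⇒x∉p (proj₂ (x∈p∩q⁻ A _ a∈A′)) (∈N⁺ y∈Y (adjacent-sym a~y))
    rearrange : ∀ w a b → (w + a) + b ≡ (a + b) + w
    rearrange = solve-∀

  critical⇒⊆maximum : ∀ {A} → CriticalIndependent G A → ∃ λ S → MaximumIndependent G S × A ⊆ S
  critical⇒⊆maximum {A} critA@(indA , _) with maximumIndependent
  ... | S , indS , maxS =
    A ∪ R , (indS′ , λ I indI → ≤-trans (maxS I indI) ∣S∣≤∣S′∣) , x∈p∪q⁺ ∘ inj₁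
    where
    open ≤-Reasoning
    R : Subset n
    R = S ∩ ∁ (N G A)
    R⊆S : R ⊆ S
    R⊆S = proj₁ ∘ x∈p∩q⁻ S _
    R∌NA : ∀ {x} → x ∈ R → ¬ x ∈ N G A
    R∌NA = x∈∁p⇒x∉p ∘ proj₂ ∘ x∈p∩q⁻ S _
    indS′ : Independent G (A ∪ R)
    indS′ i j i∈S′ j∈S′ i~j with x∈p∪q⁻ A R i∈S′ | x∈p∪q⁻ A R j∈S′
    ... | inj₁ i∈A | inj₁ j∈A = indA i j i∈A j∈A i~j
    ... | inj₁ i∈A | inj₂ j∈R = R∌NA j∈R (∈N⁺ i∈A i~j)
    ... | inj₂ i∈R | inj₁ j∈A = R∌NA i∈R (∈N⁺ j∈A (adjacent-sym i~j))
    ... | inj₂ i∈R | inj₂ j∈R = indS i j (R⊆S i∈R) (R⊆S j∈R) i~j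
    R⊆∁[A∩NY] : R ⊆ ∁ (A ∩ N G (S ∩ N G A))
    R⊆∁[A∩NY] x∈R = x∉p⇒x∈∁p λ x∈A∩NY → case ∈N⁻ (proj₂ (x∈p∩q⁻ A _ x∈A∩NY)) of λ where
      (y , y∈Y , y~x) → indS y _ (proj₁ (x∈p∩q⁻ S _ y∈Y)) (R⊆S x∈R) y~x
    ∣S∣≤∣S′∣ : ∣ S ∣ ≤ ∣ A ∪ R ∣
    ∣S∣≤∣S′∣ = begin
      ∣ S ∣                                  ≡⟨ ∣p∣≡∣p∩q∣+∣p∩∁q∣ S (N G A) ⟩
      ∣ S ∩ N G A ∣ + ∣ R ∣                  ≤⟨ +-monoˡ-≤ (∣ R ∣)
                                                  (critical⇒∣Y∣≤∣A∩NY∣ critA (proj₂ ∘ x∈p∩q⁻ S _)) ⟩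
      ∣ A ∩ N G (S ∩ N G A) ∣ + ∣ R ∣        ≤⟨ ∣p∣+∣q∣≤∣r∣ (x∈p∪q⁺ ∘ inj₁ ∘ proj₁ ∘ x∈p∩q⁻ A _)
                                                  (x∈p∪q⁺ ∘ inj₂) R⊆∁[A∩NY] ⟩
      ∣ A ∪ R ∣                              ∎

  matching⇒2k≤∣P∣+∣Q∣ : ∀ {k} → Matching G k → (P Q : Subset n) →
                        (∀ {x y} → Adjacent G x y → x ∈ P ⊎ y ∈ Q) → 2 * k ≤ ∣ P ∣ + ∣ Q ∣
  matching⇒2k≤∣P∣+∣Q∣ {k} (u , v , u~v , uv-injective) P Q covered = begin
    2 * k                                  ≡⟨ trans (∑-const k 2) (*-comm k 2) ⟨
    sum {k} (λ _ → 2)                      ≤⟨ ∑-mono-≤ (edge-weight ∘ u~v) ⟩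
    sum (λ e → h (u e) + h (v e))          ≡⟨ ∑-distrib-+ (h ∘ u) (h ∘ v) ⟩
    sum (h ∘ u) + sum (h ∘ v)              ≤⟨ ∑-pair-injective-≤ uv-injective h ⟩
    sum h                                  ≡⟨ ∑-distrib-+ (indicator P) (indicator Q) ⟩
    sum (indicator P) + sum (indicator Q)  ≡⟨ cong₂ _+_ (∣p∣≡∑indicator P) (∣p∣≡∑indicator Q) ⟨
    ∣ P ∣ + ∣ Q ∣                          ∎
    where
    open ≤-Reasoning
    h : Fin n → ℕ
    h x = indicator P x + indicator Q x
    one-way : ∀ {x y} → x ∈ P ⊎ y ∈ Q → 1 ≤ indicator P x + indicator Q y
    one-way (inj₁ x∈P) rewrite x∈p⇒indicator≡1 x∈P = s≤s z≤n
    one-way {x} (inj₂ y∈Q) rewrite x∈p⇒indicator≡1 y∈Q = m≤n+m 1 (indicator P x)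
    edge-weight : ∀ {x y} → Adjacent G x y → 2 ≤ h x + h y
    edge-weight {x} {y} x~y = begin
      2
        ≤⟨ +-mono-≤ (one-way (covered x~y)) (one-way (covered (adjacent-sym x~y))) ⟩
      (indicator P x + indicator Q y) + (indicator P y + indicator Q x)
        ≡⟨ interchange (indicator P x) (indicator Q y) (indicator P y) (indicator Q x) ⟩
      h x + h y
        ∎
      where
      interchange : ∀ a b c d → (a + b) + (c + d) ≡ (a + d) + (c + b)
      interchange = solve-∀

  KonigEgervary⇒∣S∣+μ≡n : KonigEgervary G → ∀ {S} → MaximumIndependent G S →
                          ∃ λ k → Matching G k × ∣ S ∣ + k ≡ n
  KonigEgervary⇒∣S∣+μ≡n (S₀ , k , (indS₀ , maxS₀) , (M , _) , ∣S₀∣+k≡n) {S} (indS , maxS) =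
    k , M , trans (cong (_+ k) (≤-antisym (maxS₀ S indS) (maxS S₀ indS₀))) ∣S₀∣+k≡n

  KonigEgervary⇒maximum-critical : KonigEgervary G → ∀ {S} → MaximumIndependent G S →
                                   CriticalIndependent G S
  KonigEgervary⇒maximum-critical ke {S} maxS@(indS , _) with KonigEgervary⇒∣S∣+μ≡n ke maxS
  ... | k , M , ∣S∣+k≡n = indS , λ I _ → Equivalence.from (d≤d⇔ I S) (begin
    ∣ I ∣ + ∣ N G S ∣      ≤⟨ +-monoʳ-≤ (∣ I ∣) ∣NS∣≤k ⟩
    ∣ I ∣ + k              ≤⟨ +-cancelʳ-≤ k _ _ (∣I∣+2k≤∣S∣+∣NI∣+k I) ⟩
    ∣ S ∣ + ∣ N G I ∣      ∎)
    where
    open ≤-Reasoning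
    ∣NS∣≤k : ∣ N G S ∣ ≤ k
    ∣NS∣≤k = +-cancelˡ-≤ (∣ S ∣) _ _
      (≤-trans (independent⇒∣A∣+∣NA∣≤n indS) (≤-reflexive (sym ∣S∣+k≡n)))
    leaves-or-enters-N : ∀ I {x y} → Adjacent G x y → x ∈ ∁ I ⊎ y ∈ N G I
    leaves-or-enters-N I {x} x~y with x ∈? I
    ... | yes x∈I = inj₂ (∈N⁺ x∈I x~y)
    ... | no  x∉I = inj₁ (x∉p⇒x∈∁p x∉I)
    ∣I∣+2k≤∣S∣+∣NI∣+k : ∀ I → (∣ I ∣ + k) + k ≤ (∣ S ∣ + ∣ N G I ∣) + k
    ∣I∣+2k≤∣S∣+∣NI∣+k I = begin
      (∣ I ∣ + k) + k                  ≡⟨ twice (∣ I ∣) k ⟩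
      ∣ I ∣ + 2 * k                    ≤⟨ +-monoʳ-≤ (∣ I ∣)
                                            (matching⇒2k≤∣P∣+∣Q∣ M (∁ I) (N G I) (leaves-or-enters-N I)) ⟩
      ∣ I ∣ + (∣ ∁ I ∣ + ∣ N G I ∣)    ≡⟨ +-assoc (∣ I ∣) _ _ ⟨
      (∣ I ∣ + ∣ ∁ I ∣) + ∣ N G I ∣    ≡⟨ cong (_+ ∣ N G I ∣) (trans (∣p∣+∣∁p∣≡n I) (sym ∣S∣+k≡n)) ⟩
      (∣ S ∣ + k) + ∣ N G I ∣          ≡⟨ right-comm (∣ S ∣) k (∣ N G I ∣) ⟩
      (∣ S ∣ + ∣ N G I ∣) + k          ∎
      where
      twice : ∀ a b → (a + b) + b ≡ a + 2 * b
      twice = solve-∀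
      right-comm : ∀ a b c → (a + b) + c ≡ (a + c) + b
      right-comm = solve-∀

  diadem⊆corona : ∀ x → InDiadem G x → InCorona G x
  diadem⊆corona x (A , critA , x∈A) with critical⇒⊆maximum critA
  ... | S , maxS , A⊆S = S , maxS , A⊆S x∈A

  KonigEgervary⇒corona⊆diadem : KonigEgervary G → ∀ x → InCorona G x → InDiadem G x
  KonigEgervary⇒corona⊆diadem ke x (S , maxS , x∈S) =
    S , KonigEgervary⇒maximum-critical ke maxS , x∈S

  -- Both endpoints would lie in a maximum set through y, which is critical and so contains ker(G).
  KonigEgervary⇒ker-diadem-nonadjacent : KonigEgervary G → ∀ {K D} → IsKer G K → IsDiadem G D →
                                          ∀ {x y} → x ∈ K → y ∈ D → ¬ Adjacent G x y
  KonigEgervary⇒ker-diadem-nonadjacent ke isK isD {x} {y} x∈K y∈D x~y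
    with diadem⊆corona y (proj₁ (isD y) y∈D)
  ... | S , maxS@(indS , _) , y∈S =
    indS x y (proj₁ (isK x) x∈K S (KonigEgervary⇒maximum-critical ke maxS)) y∈S x~y

  KonigEgervary⇒∣ker∣+∣diadem∣≤2α : KonigEgervary G → ∀ K D S → IsKer G K → IsDiadem G D →
                                    MaximumIndependent G S → ∣ K ∣ + ∣ D ∣ ≤ 2 * ∣ S ∣
  KonigEgervary⇒∣ker∣+∣diadem∣≤2α ke K D S isK isD maxS with KonigEgervary⇒∣S∣+μ≡n ke maxS
  ... | k , M , ∣S∣+k≡n = +-cancelʳ-≤ (2 * k) _ _ (begin
    (∣ K ∣ + ∣ D ∣) + 2 * k              ≤⟨ +-monoʳ-≤ (∣ K ∣ + ∣ D ∣)
                                              (matching⇒2k≤∣P∣+∣Q∣ M (∁ K) (∁ D) leaves-K-or-D) ⟩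
    (∣ K ∣ + ∣ D ∣) + (∣ ∁ K ∣ + ∣ ∁ D ∣) ≡⟨ interchange (∣ K ∣) (∣ D ∣) (∣ ∁ K ∣) (∣ ∁ D ∣) ⟩
    (∣ K ∣ + ∣ ∁ K ∣) + (∣ D ∣ + ∣ ∁ D ∣) ≡⟨ cong₂ _+_ (∣p∣+∣∁p∣≡n K) (∣p∣+∣∁p∣≡n D) ⟩
    n + n                                ≡⟨ cong₂ _+_ ∣S∣+k≡n ∣S∣+k≡n ⟨
    (∣ S ∣ + k) + (∣ S ∣ + k)            ≡⟨ double-sum (∣ S ∣) k ⟩
    2 * ∣ S ∣ + 2 * k                    ∎)
    where
    open ≤-Reasoning
    leaves-K-or-D : ∀ {x y} → Adjacent G x y → x ∈ ∁ K ⊎ y ∈ ∁ D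
    leaves-K-or-D {x} {y} x~y with x ∈? K | y ∈? D
    ... | no  x∉K | _       = inj₁ (x∉p⇒x∈∁p x∉K)
    ... | yes _   | no  y∉D = inj₂ (x∉p⇒x∈∁p y∉D)
    ... | yes x∈K | yes y∈D =
      ⊥-elim (KonigEgervary⇒ker-diadem-nonadjacent ke isK isD x∈K y∈D x~y)
    interchange : ∀ a b c d → (a + b) + (c + d) ≡ (a + c) + (b + d)
    interchange = solve-∀
    double-sum : ∀ s k → (s + k) + (s + k) ≡ 2 * s + 2 * k
    double-sum = solve-∀

theorem4p1 : ∀ (n : ℕ) (G : Graph n) →
    ((∀ (x : Fin n) → InDiadem G x → InCorona G x)
      × (KonigEgervary G → ∀ (x : Fin n) → InDiadem G x ⇔ InCorona G x))
    × (KonigEgervary G → ∀ (K D S : Subset n) → IsKer G K → IsDiadem G D →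
        MaximumIndependent G S → ∣ K ∣ + ∣ D ∣ ≤ 2 * ∣ S ∣)
theorem4p1 n G =
  ( diadem⊆corona G
  , λ ke x → mk⇔ (diadem⊆corona G x) (KonigEgervary⇒corona⊆diadem G ke x) )
  , KonigEgervary⇒∣ker∣+∣diadem∣≤2α G
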